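{- Let $A$ be a finite ring with multiplicative group of units $A^*$, and for $n\ge0$ let $A^{(n)}=\{(a_1,\dots,a_n)\in A^n : a_ia_j=a_ja_i \text{ for } 1\le i,j\le n\}$. Let $A^*$ act on $A^{(n)}$ by $u\cdot(a_1,\dots,a_n)=(ua_1u^{ -1},\dots,ua_nu^{ -1})$, and let $c_A(n)$ be the number of orbits of this action. Then the generating function $h_A(t)=\sum_{n=0}^\infty c_A(n)t^n$ is a rational function of $t$. -}

module Defs where

open import Level using (Level; _⊔_)
open import Algebra.Bundles using (Ring)
open import Data.Nat using (ℕ; zero; suc)
open import Data.Fin using (Fin)
open import Data.Integer as ℤ using (ℤ)
open import Data.List using (List; []; _∷_)
open import Data.Product using (Σ; _×_; ∃)
open import Function.Bundles using (Inverse)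
open import Relation.Binary.PropositionalEquality as ≡ using (_≡_)
open import Relation.Nullary using (¬_)

FiniteRing : ∀ {c ℓ} → Ring c ℓ → Set (c ⊔ ℓ)
FiniteRing R = Σ ℕ λ k → Inverse (Ring.setoid R) (≡.setoid (Fin k))

module _ {c ℓ} (R : Ring c ℓ) where
  open Ring R

  Tuple : ℕ → Set c
  Tuple n = Fin n → Carrier

  Commuting : ∀ {n} → Tuple n → Set ℓ
  Commuting a = ∀ i j → a i * a j ≈ a j * a i

  Conj : ∀ {n} → Tuple n → Tuple n → Set (c ⊔ ℓ)
  Conj a b = Σ Carrier λ u → Σ Carrier λ v →
               (u * v ≈ 1#) × (v * u ≈ 1#) × (∀ i → u * a i * v ≈ b i)

  OrbitCount : ℕ → ℕ → Set (c ⊔ ℓ)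
  OrbitCount n m =
    Σ (Fin m → Tuple n) λ rep →
      (∀ k → Commuting (rep k)) ×
      (∀ k l → Conj (rep k) (rep l) → k ≡ l) ×
      (∀ (a : Tuple n) → Commuting a → ∃ λ k → Conj a (rep k))

-- Polynomials with integer coefficients as coefficient lists (constant term first).
coeff : List ℤ → ℕ → ℤ
coeff []       n       = ℤ.0ℤ
coeff (p ∷ ps) zero    = p
coeff (p ∷ ps) (suc n) = coeff ps n

polyTimesSeries : List ℤ → (ℕ → ℤ) → ℕ → ℤ
polyTimesSeries []       h n       = ℤ.0ℤ
polyTimesSeries (q ∷ qs) h zero    = q ℤ.* h zero
polyTimesSeries (q ∷ qs) h (suc n) = q ℤ.* h (suc n) ℤ.+ polyTimesSeries qs h n

IsRationalSeries : (ℕ → ℤ) → Set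
IsRationalSeries h =
  Σ (List ℤ) λ Q → Σ (List ℤ) λ P →
    (¬ coeff Q 0 ≡ ℤ.0ℤ) × (∀ n → polyTimesSeries Q h n ≡ coeff P n)

-- A tuple a ∈ Aⁿ factors uniquely as a = v ∘ π, where the set partition π of {1,…,n} into j blocks
-- records which entries of a coincide and v is a j-tuple of pairwise distinct elements, so j ≤ |A|.
-- Conjugation by a unit preserves π and acts on v, and a is commuting iff v is. Hence
-- c_A(n) = Σ_{j ≤ |A|} S(n, j) d_j, where S(n, j) are the Stirling numbers of the second kind and d_j,
-- the number of orbits of commuting j-tuples of distinct elements, does not depend on n.
-- Each Σ_n S(n, j) tⁿ = t^j / ∏_{i ≤ j} (1 - i t) is rational, and rational series form a ℤ-module.

module Submission where

open import Defs
open import Algebra.Bundles using (Ring)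
open import Data.Nat using (ℕ)
open import Data.Integer using (+_)
open import Data.Product using (Σ; _×_; _,_)

module RationalSeries where
  open import Data.Nat as ℕ using (zero; suc)
  open import Data.Nat.Properties using (+-0-monoid)
  open import Algebra.Properties.Monoid.Sum +-0-monoid using (sum)
  open import Data.Fin using (Fin; zero; suc)
  open import Data.Integer using (ℤ; 0ℤ; 1ℤ; -_; _+_; _*_)
  open import Data.Integer.Properties
  open import Data.Integer.Tactic.RingSolver using (solve-∀)
  open import Algebra.Properties.CommutativeSemigroup +-commutativeSemigroup using (interchange)
  open import Data.List using (List; []; _∷_; [_])
  open import Data.Sum using (inj₁; inj₂)
  open import Relation.Binary.PropositionalEquality using (_≡_; _≗_; refl; sym; trans; cong; cong₂; module ≡-Reasoning)
  open import Relation.Nullary using (¬_)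
  open ≡-Reasoning

  Series : Set
  Series = ℕ → ℤ

  infixl 6 _⊕_ _+ₚ_
  infixl 7 _*ₚ_
  infixr 7 _⊙_ _·ₚ_ _⊛_

  _⊕_ : Series → Series → Series
  (f ⊕ g) n = f n + g n

  _⊙_ : ℤ → Series → Series
  (c ⊙ f) n = c * f n

  shift : Series → Series
  shift f zero    = 0ℤ
  shift f (suc n) = f n

  _⊛_ : List ℤ → Series → Series
  _⊛_ = polyTimesSeries

  _+ₚ_ : List ℤ → List ℤ → List ℤ
  []      +ₚ q       = q
  (a ∷ p) +ₚ []      = a ∷ p
  (a ∷ p) +ₚ (b ∷ q) = a + b ∷ p +ₚ q

  _·ₚ_ : ℤ → List ℤ → List ℤ
  c ·ₚ []      = []
  c ·ₚ (a ∷ p) = c * a ∷ c ·ₚ p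

  _*ₚ_ : List ℤ → List ℤ → List ℤ
  []      *ₚ q = []
  (a ∷ p) *ₚ q = a ·ₚ q +ₚ (0ℤ ∷ p *ₚ q)

  coeff-+ₚ : ∀ p q → coeff (p +ₚ q) ≗ coeff p ⊕ coeff q
  coeff-+ₚ []      q       n       = sym (+-identityˡ _)
  coeff-+ₚ (a ∷ p) []      n       = sym (+-identityʳ _)
  coeff-+ₚ (a ∷ p) (b ∷ q) zero    = refl
  coeff-+ₚ (a ∷ p) (b ∷ q) (suc n) = coeff-+ₚ p q n

  coeff-·ₚ : ∀ c p → coeff (c ·ₚ p) ≗ c ⊙ coeff p
  coeff-·ₚ c []      n       = sym (*-zeroʳ c)
  coeff-·ₚ c (a ∷ p) zero    = refl
  coeff-·ₚ c (a ∷ p) (suc n) = coeff-·ₚ c p n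

  ⊛-congʳ : ∀ p {f g} → f ≗ g → p ⊛ f ≗ p ⊛ g
  ⊛-congʳ []      f≗g n       = refl
  ⊛-congʳ (a ∷ p) f≗g zero    = cong (a *_) (f≗g zero)
  ⊛-congʳ (a ∷ p) f≗g (suc n) = cong₂ _+_ (cong (a *_) (f≗g (suc n))) (⊛-congʳ p f≗g n)

  ⊛-∷ : ∀ a p f → (a ∷ p) ⊛ f ≗ a ⊙ f ⊕ shift (p ⊛ f)
  ⊛-∷ a p f zero    = sym (+-identityʳ _)
  ⊛-∷ a p f (suc n) = refl

  ⊛-singleton : ∀ a f → [ a ] ⊛ f ≗ a ⊙ f
  ⊛-singleton a f zero    = refl
  ⊛-singleton a f (suc n) = +-identityʳ _

  ⊛-zeroʳ : ∀ p → p ⊛ (λ _ → 0ℤ) ≗ λ _ → 0ℤ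
  ⊛-zeroʳ []      n       = refl
  ⊛-zeroʳ (a ∷ p) zero    = *-zeroʳ a
  ⊛-zeroʳ (a ∷ p) (suc n) = cong₂ _+_ (*-zeroʳ a) (⊛-zeroʳ p n)

  ⊛-at-0 : ∀ p f → (p ⊛ f) 0 ≡ coeff p 0 * f 0
  ⊛-at-0 []      f = refl
  ⊛-at-0 (a ∷ p) f = refl

  ⊛-distribʳ-+ₚ : ∀ p q f → (p +ₚ q) ⊛ f ≗ p ⊛ f ⊕ q ⊛ f
  ⊛-distribʳ-+ₚ []      q       f n       = sym (+-identityˡ _)
  ⊛-distribʳ-+ₚ (a ∷ p) []      f n       = sym (+-identityʳ _)
  ⊛-distribʳ-+ₚ (a ∷ p) (b ∷ q) f zero    = *-distribʳ-+ (f zero) a b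
  ⊛-distribʳ-+ₚ (a ∷ p) (b ∷ q) f (suc n) = begin
    (a + b) * f (suc n) + ((p +ₚ q) ⊛ f) n
      ≡⟨ cong₂ _+_ (*-distribʳ-+ (f (suc n)) a b) (⊛-distribʳ-+ₚ p q f n) ⟩
    (a * f (suc n) + b * f (suc n)) + ((p ⊛ f) n + (q ⊛ f) n)
      ≡⟨ interchange (a * f (suc n)) _ ((p ⊛ f) n) _ ⟩
    (a * f (suc n) + (p ⊛ f) n) + (b * f (suc n) + (q ⊛ f) n) ∎

  ⊛-distribˡ-⊕ : ∀ p f g → p ⊛ (f ⊕ g) ≗ p ⊛ f ⊕ p ⊛ g
  ⊛-distribˡ-⊕ []      f g n       = refl
  ⊛-distribˡ-⊕ (a ∷ p) f g zero    = *-distribˡ-+ a (f zero) (g zero)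
  ⊛-distribˡ-⊕ (a ∷ p) f g (suc n) = begin
    a * (f (suc n) + g (suc n)) + (p ⊛ (f ⊕ g)) n
      ≡⟨ cong₂ _+_ (*-distribˡ-+ a (f (suc n)) (g (suc n))) (⊛-distribˡ-⊕ p f g n) ⟩
    (a * f (suc n) + a * g (suc n)) + ((p ⊛ f) n + (p ⊛ g) n)
      ≡⟨ interchange (a * f (suc n)) _ ((p ⊛ f) n) _ ⟩
    (a * f (suc n) + (p ⊛ f) n) + (a * g (suc n) + (p ⊛ g) n) ∎

  ⊛-·ₚ : ∀ c p f → (c ·ₚ p) ⊛ f ≗ c ⊙ p ⊛ f
  ⊛-·ₚ c []      f n       = sym (*-zeroʳ c)
  ⊛-·ₚ c (a ∷ p) f zero    = *-assoc c a (f zero)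
  ⊛-·ₚ c (a ∷ p) f (suc n) = begin
    c * a * f (suc n) + ((c ·ₚ p) ⊛ f) n   ≡⟨ cong (_+_ (c * a * f (suc n))) (⊛-·ₚ c p f n) ⟩
    c * a * f (suc n) + c * (p ⊛ f) n      ≡⟨ factor c a (f (suc n)) _ ⟩
    c * (a * f (suc n) + (p ⊛ f) n)        ∎
    where factor : ∀ c a x y → c * a * x + c * y ≡ c * (a * x + y)
          factor = solve-∀

  ⊛-⊙ : ∀ p c f → p ⊛ (c ⊙ f) ≗ c ⊙ p ⊛ f
  ⊛-⊙ []      c f n       = sym (*-zeroʳ c)
  ⊛-⊙ (a ∷ p) c f zero    = swap a c (f zero)
    where swap : ∀ a c x → a * (c * x) ≡ c * (a * x)
          swap = solve-∀
  ⊛-⊙ (a ∷ p) c f (suc n) = begin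
    a * (c * f (suc n)) + (p ⊛ (c ⊙ f)) n   ≡⟨ cong (_+_ (a * (c * f (suc n)))) (⊛-⊙ p c f n) ⟩
    a * (c * f (suc n)) + c * (p ⊛ f) n     ≡⟨ factor a c (f (suc n)) _ ⟩
    c * (a * f (suc n) + (p ⊛ f) n)         ∎
    where factor : ∀ a c x y → a * (c * x) + c * y ≡ c * (a * x + y)
          factor = solve-∀

  ⊛-shift : ∀ p f → p ⊛ shift f ≗ shift (p ⊛ f)
  ⊛-shift []      f zero          = refl
  ⊛-shift []      f (suc n)       = refl
  ⊛-shift (a ∷ p) f zero          = *-zeroʳ a
  ⊛-shift (a ∷ p) f (suc zero)    = trans (cong (_+_ (a * f zero)) (⊛-shift p f zero)) (+-identityʳ _)
  ⊛-shift (a ∷ p) f (suc (suc n)) = cong (_+_ (a * f (suc n))) (⊛-shift p f (suc n))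

  ⊛-*ₚ : ∀ p q f → (p *ₚ q) ⊛ f ≗ p ⊛ (q ⊛ f)
  ⊛-*ₚ []      q f n       = refl
  ⊛-*ₚ (a ∷ p) q f zero    = begin
    ((a ·ₚ q +ₚ (0ℤ ∷ p *ₚ q)) ⊛ f) 0      ≡⟨ ⊛-distribʳ-+ₚ (a ·ₚ q) (0ℤ ∷ p *ₚ q) f 0 ⟩
    ((a ·ₚ q) ⊛ f) 0 + 0ℤ * f 0           ≡⟨ +-identityʳ _ ⟩
    ((a ·ₚ q) ⊛ f) 0                      ≡⟨ ⊛-·ₚ a q f 0 ⟩
    a * (q ⊛ f) 0                         ∎
  ⊛-*ₚ (a ∷ p) q f (suc n) = begin
    ((a ·ₚ q +ₚ (0ℤ ∷ p *ₚ q)) ⊛ f) (suc n)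
      ≡⟨ ⊛-distribʳ-+ₚ (a ·ₚ q) (0ℤ ∷ p *ₚ q) f (suc n) ⟩
    ((a ·ₚ q) ⊛ f) (suc n) + (0ℤ * f (suc n) + ((p *ₚ q) ⊛ f) n)
      ≡⟨ cong₂ _+_ (⊛-·ₚ a q f (suc n)) (+-identityˡ _) ⟩
    a * (q ⊛ f) (suc n) + ((p *ₚ q) ⊛ f) n
      ≡⟨ cong (_+_ (a * (q ⊛ f) (suc n))) (⊛-*ₚ p q f n) ⟩
    a * (q ⊛ f) (suc n) + (p ⊛ (q ⊛ f)) n ∎

  ⊛-comm : ∀ p q f → p ⊛ (q ⊛ f) ≗ q ⊛ (p ⊛ f)
  ⊛-comm []      q f n = sym (⊛-zeroʳ q n)
  ⊛-comm (a ∷ p) q f n = begin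
    ((a ∷ p) ⊛ (q ⊛ f)) n                    ≡⟨ ⊛-∷ a p (q ⊛ f) n ⟩
    a * (q ⊛ f) n + shift (p ⊛ (q ⊛ f)) n    ≡⟨ cong (_+_ (a * (q ⊛ f) n)) (shift-comm n) ⟩
    a * (q ⊛ f) n + shift (q ⊛ (p ⊛ f)) n    ≡⟨ cong₂ _+_ (⊛-⊙ q a f n) (⊛-shift q (p ⊛ f) n) ⟨
    (q ⊛ (a ⊙ f)) n + (q ⊛ shift (p ⊛ f)) n  ≡⟨ ⊛-distribˡ-⊕ q (a ⊙ f) (shift (p ⊛ f)) n ⟨
    (q ⊛ (a ⊙ f ⊕ shift (p ⊛ f))) n          ≡⟨ ⊛-congʳ q (⊛-∷ a p f) n ⟨
    (q ⊛ ((a ∷ p) ⊛ f)) n                    ∎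
    where
    shift-comm : shift (p ⊛ (q ⊛ f)) ≗ shift (q ⊛ (p ⊛ f))
    shift-comm zero    = refl
    shift-comm (suc n) = ⊛-comm p q f n

  ⊛-coeff : ∀ p q → p ⊛ coeff q ≗ coeff (p *ₚ q)
  ⊛-coeff p q n = begin
    (p ⊛ coeff q) n                 ≡⟨ ⊛-congʳ p (⊛-one q) n ⟨
    (p ⊛ (q ⊛ coeff [ 1ℤ ])) n      ≡⟨ ⊛-*ₚ p q (coeff [ 1ℤ ]) n ⟨
    ((p *ₚ q) ⊛ coeff [ 1ℤ ]) n     ≡⟨ ⊛-one (p *ₚ q) n ⟩
    coeff (p *ₚ q) n                ∎
    where
    ⊛-one : ∀ p → p ⊛ coeff [ 1ℤ ] ≗ coeff p
    ⊛-one []      n       = refl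
    ⊛-one (a ∷ p) zero    = *-identityʳ a
    ⊛-one (a ∷ p) (suc n) = trans (cong₂ _+_ (*-zeroʳ a) (⊛-one p n)) (+-identityˡ _)

  coeff-*ₚ-0 : ∀ p q → coeff (p *ₚ q) 0 ≡ coeff p 0 * coeff q 0
  coeff-*ₚ-0 p q = trans (sym (⊛-coeff p q 0)) (⊛-at-0 p (coeff q))

  *ₚ-constant≢0 : ∀ p q → ¬ coeff p 0 ≡ 0ℤ → ¬ coeff q 0 ≡ 0ℤ → ¬ coeff (p *ₚ q) 0 ≡ 0ℤ
  *ₚ-constant≢0 p q p₀≢0 q₀≢0 pq₀≡0 with i*j≡0⇒i≡0∨j≡0 (coeff p 0) (trans (sym (coeff-*ₚ-0 p q)) pq₀≡0)
  ... | inj₁ p₀≡0 = p₀≢0 p₀≡0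
  ... | inj₂ q₀≡0 = q₀≢0 q₀≡0

  ⊛-*ₚ-comm : ∀ p q f → (p *ₚ q) ⊛ f ≗ (q *ₚ p) ⊛ f
  ⊛-*ₚ-comm p q f n = begin
    ((p *ₚ q) ⊛ f) n    ≡⟨ ⊛-*ₚ p q f n ⟩
    (p ⊛ (q ⊛ f)) n     ≡⟨ ⊛-comm p q f n ⟩
    (q ⊛ (p ⊛ f)) n     ≡⟨ ⊛-*ₚ q p f n ⟨
    ((q *ₚ p) ⊛ f) n    ∎

  ⊛-*ₚˡ : ∀ r {q p f} → q ⊛ f ≗ coeff p → (r *ₚ q) ⊛ f ≗ coeff (r *ₚ p)
  ⊛-*ₚˡ r {q} {p} {f} qf≗p n = begin
    ((r *ₚ q) ⊛ f) n     ≡⟨ ⊛-*ₚ r q f n ⟩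
    (r ⊛ (q ⊛ f)) n      ≡⟨ ⊛-congʳ r qf≗p n ⟩
    (r ⊛ coeff p) n      ≡⟨ ⊛-coeff r p n ⟩
    coeff (r *ₚ p) n     ∎

  IsRationalSeries-resp : ∀ {f g} → f ≗ g → IsRationalSeries f → IsRationalSeries g
  IsRationalSeries-resp f≗g (q , p , q₀≢0 , qf≗p) =
    q , p , q₀≢0 , λ n → trans (sym (⊛-congʳ q f≗g n)) (qf≗p n)

  coeff-isRational : ∀ p → IsRationalSeries (coeff p)
  coeff-isRational p = [ 1ℤ ] , p , (λ ()) , λ n → trans (⊛-∷ 1ℤ [] (coeff p) n) (one n)
    where
    one : 1ℤ ⊙ coeff p ⊕ shift ([] ⊛ coeff p) ≗ coeff p
    one zero    = trans (+-identityʳ _) (*-identityˡ _)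
    one (suc n) = trans (+-identityʳ _) (*-identityˡ _)

  ⊙-isRational : ∀ c {f} → IsRationalSeries f → IsRationalSeries (c ⊙ f)
  ⊙-isRational c {f} (q , p , q₀≢0 , qf≗p) = q , c ·ₚ p , q₀≢0 , λ n → begin
    (q ⊛ (c ⊙ f)) n     ≡⟨ ⊛-⊙ q c f n ⟩
    c * (q ⊛ f) n       ≡⟨ cong (c *_) (qf≗p n) ⟩
    c * coeff p n       ≡⟨ coeff-·ₚ c p n ⟨
    coeff (c ·ₚ p) n    ∎

  ⊕-isRational : ∀ {f g} → IsRationalSeries f → IsRationalSeries g → IsRationalSeries (f ⊕ g)
  ⊕-isRational {f} {g} (q₁ , p₁ , q₁₀≢0 , q₁f≗p₁) (q₂ , p₂ , q₂₀≢0 , q₂g≗p₂) =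
    q₁ *ₚ q₂ , q₂ *ₚ p₁ +ₚ q₁ *ₚ p₂ , *ₚ-constant≢0 q₁ q₂ q₁₀≢0 q₂₀≢0 , λ n → begin
      ((q₁ *ₚ q₂) ⊛ (f ⊕ g)) n                         ≡⟨ ⊛-distribˡ-⊕ (q₁ *ₚ q₂) f g n ⟩
      ((q₁ *ₚ q₂) ⊛ f) n + ((q₁ *ₚ q₂) ⊛ g) n          ≡⟨ cong (_+ _) (⊛-*ₚ-comm q₁ q₂ f n) ⟩
      ((q₂ *ₚ q₁) ⊛ f) n + ((q₁ *ₚ q₂) ⊛ g) n          ≡⟨ cong₂ _+_ (⊛-*ₚˡ q₂ q₁f≗p₁ n) (⊛-*ₚˡ q₁ q₂g≗p₂ n) ⟩
      coeff (q₂ *ₚ p₁) n + coeff (q₁ *ₚ p₂) n          ≡⟨ coeff-+ₚ (q₂ *ₚ p₁) (q₁ *ₚ p₂) n ⟨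
      coeff (q₂ *ₚ p₁ +ₚ q₁ *ₚ p₂) n                   ∎

  -- (1 - c t) f = f 0 + t g, so q (1 - c t) is a denominator for f when q is one for g.
  recurrence-isRational : ∀ c {f g} → (∀ n → f (suc n) ≡ c * f n + g n) →
                          IsRationalSeries g → IsRationalSeries f
  recurrence-isRational c {f} {g} rec (q , p , q₀≢0 , qg≗p) =
    q *ₚ one-minus-ct , q *ₚ [ f 0 ] +ₚ (0ℤ ∷ p) , *ₚ-constant≢0 q one-minus-ct q₀≢0 (λ ()) , λ n → begin
      ((q *ₚ one-minus-ct) ⊛ f) n                       ≡⟨ ⊛-*ₚ q one-minus-ct f n ⟩
      (q ⊛ (one-minus-ct ⊛ f)) n                        ≡⟨ ⊛-congʳ q one-minus-ct⊛f n ⟩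
      (q ⊛ (coeff [ f 0 ] ⊕ shift g)) n                 ≡⟨ ⊛-distribˡ-⊕ q _ _ n ⟩
      (q ⊛ coeff [ f 0 ]) n + (q ⊛ shift g) n           ≡⟨ cong₂ _+_ (⊛-coeff q [ f 0 ] n) (⊛-shift q g n) ⟩
      coeff (q *ₚ [ f 0 ]) n + shift (q ⊛ g) n          ≡⟨ cong (_+_ (coeff (q *ₚ [ f 0 ]) n)) (shifted n) ⟩
      coeff (q *ₚ [ f 0 ]) n + coeff (0ℤ ∷ p) n         ≡⟨ coeff-+ₚ (q *ₚ [ f 0 ]) (0ℤ ∷ p) n ⟨
      coeff (q *ₚ [ f 0 ] +ₚ (0ℤ ∷ p)) n                ∎
    where
    one-minus-ct : List ℤ
    one-minus-ct = 1ℤ ∷ - c ∷ []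
    cancel : ∀ c x y → 1ℤ * (c * x + y) + - c * x ≡ 0ℤ + y
    cancel = solve-∀
    one-minus-ct⊛f : one-minus-ct ⊛ f ≗ coeff [ f 0 ] ⊕ shift g
    one-minus-ct⊛f zero    = trans (*-identityˡ _) (sym (+-identityʳ _))
    one-minus-ct⊛f (suc n) = begin
      1ℤ * f (suc n) + ([ - c ] ⊛ f) n    ≡⟨ cong₂ (λ x y → 1ℤ * x + y) (rec n) (⊛-singleton (- c) f n) ⟩
      1ℤ * (c * f n + g n) + - c * f n    ≡⟨ cancel c (f n) (g n) ⟩
      0ℤ + g n                            ∎
    shifted : shift (q ⊛ g) ≗ coeff (0ℤ ∷ p)
    shifted zero    = refl
    shifted (suc n) = qg≗p n

  ∑-isRational : ∀ K (f : Fin K → ℕ → ℕ) → (∀ j → IsRationalSeries (λ n → + f j n)) →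
                 IsRationalSeries (λ n → + sum (λ j → f j n))
  ∑-isRational zero    f f-rat = coeff-isRational []
  ∑-isRational (suc K) f f-rat =
    IsRationalSeries-resp (λ n → sym (pos-+ (f zero n) _))
      (⊕-isRational (f-rat zero) (∑-isRational K (λ j → f (suc j)) (λ j → f-rat (suc j))))

  *-isRational : ∀ d {f : ℕ → ℕ} → IsRationalSeries (λ n → + f n) → IsRationalSeries (λ n → + (f n ℕ.* d))
  *-isRational d {f} f-rat =
    IsRationalSeries-resp (λ n → trans (*-comm (+ d) (+ f n)) (sym (pos-* (f n) d))) (⊙-isRational (+ d) f-rat)

module SetPartitions where
  open import Data.Nat using (zero; suc; _+_; _*_)
  open import Data.Fin using (Fin; zero; suc)
  open import Data.Fin.Properties using (suc-injective; +↔⊎; *↔×)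
  open import Data.Integer as ℤ using (1ℤ)
  open import Data.Integer.Properties using (pos-+; pos-*; +-comm)
  open import Data.List using ([_])
  open import Data.Product using (∃; proj₁; proj₂)
  open import Data.Sum using (_⊎_; inj₁; inj₂)
  open import Data.Sum.Function.Propositional using (_⊎-↔_)
  open import Data.Product.Function.NonDependent.Propositional using (_×-↔_)
  open import Function.Bundles using (_↔_; mk↔ₛ′)
  open import Function.Properties.Inverse using (↔-refl; ↔-sym; ↔-trans)
  open import Relation.Binary.PropositionalEquality using (_≡_; refl; sym; trans; cong; module ≡-Reasoning)
  open RationalSeries using (coeff-isRational; recurrence-isRational; IsRationalSeries-resp)

  stirling₂ : ℕ → ℕ → ℕ
  stirling₂ zero    zero    = 1
  stirling₂ zero    (suc j) = 0
  stirling₂ (suc n) zero    = 0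
  stirling₂ (suc n) (suc j) = stirling₂ n j + suc j * stirling₂ n (suc j)

  -- Point 0 either forms a new block, which gets label 0, or joins one of the j blocks of the rest.
  data SetPartition : ℕ → ℕ → Set where
    []  : SetPartition 0 0
    new : ∀ {n j} → SetPartition n j → SetPartition (suc n) (suc j)
    old : ∀ {n j} → Fin j → SetPartition n j → SetPartition (suc n) j

  block : ∀ {n j} → SetPartition n j → Fin n → Fin j
  block (new σ)   zero    = zero
  block (new σ)   (suc i) = suc (block σ i)
  block (old l σ) zero    = l
  block (old l σ) (suc i) = block σ i

  block-surjective : ∀ {n j} (σ : SetPartition n j) l → ∃ λ i → block σ i ≡ l
  block-surjective (new σ)    zero    = zero , refl
  block-surjective (new σ)    (suc l) = let i , eq = block-surjective σ l in suc i , cong suc eq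
  block-surjective (old l₀ σ) l       = let i , eq = block-surjective σ l in suc i , eq

  SameBlocks : ∀ {n j j′} → SetPartition n j → SetPartition n j′ → Set
  SameBlocks σ σ′ = ∀ i i′ → (block σ i ≡ block σ i′ → block σ′ i ≡ block σ′ i′)
                           × (block σ′ i ≡ block σ′ i′ → block σ i ≡ block σ i′)

  sameBlocks⇒≡ : ∀ {n j j′} (σ : SetPartition n j) (σ′ : SetPartition n j′) →
                 SameBlocks σ σ′ → _≡_ {A = Σ ℕ (SetPartition n)} (j , σ) (j′ , σ′)
  sameBlocks⇒≡ [] [] same = refl
  sameBlocks⇒≡ (new σ) (new σ′) same
    with refl ← sameBlocks⇒≡ σ σ′ (λ i i′ →
           (λ eq → suc-injective (proj₁ (same (suc i) (suc i′)) (cong suc eq))) ,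
           (λ eq → suc-injective (proj₂ (same (suc i) (suc i′)) (cong suc eq))))
    = refl
  sameBlocks⇒≡ (new σ) (old l′ σ′) same with block-surjective σ′ l′
  ... | i , eq with () ← proj₂ (same zero (suc i)) (sym eq)
  sameBlocks⇒≡ (old l σ) (new σ′) same with block-surjective σ l
  ... | i , eq with () ← proj₁ (same zero (suc i)) (sym eq)
  sameBlocks⇒≡ (old l σ) (old l′ σ′) same
    with refl ← sameBlocks⇒≡ σ σ′ (λ i i′ → same (suc i) (suc i′))
    with i , eq ← block-surjective σ l
    = cong (λ l″ → _ , old l″ σ) (trans (sym eq) (sym (proj₁ (same zero (suc i)) (sym eq))))

  SetPartition↔stirling₂ : ∀ n j → SetPartition n j ↔ Fin (stirling₂ n j)
  SetPartition↔stirling₂ zero    zero    =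
    mk↔ₛ′ (λ { [] → zero }) (λ { zero → [] }) (λ { zero → refl }) (λ { [] → refl })
  SetPartition↔stirling₂ zero    (suc j) = mk↔ₛ′ (λ ()) (λ ()) (λ ()) (λ ())
  SetPartition↔stirling₂ (suc n) zero    =
    mk↔ₛ′ (λ { (old () _) }) (λ ()) (λ ()) (λ { (old () _) })
  SetPartition↔stirling₂ (suc n) (suc j) =
    ↔-trans (mk↔ₛ′ split join split-join join-split)
      (↔-trans (SetPartition↔stirling₂ n j ⊎-↔ (↔-trans (↔-refl ×-↔ SetPartition↔stirling₂ n (suc j)) (↔-sym *↔×)))
        (↔-sym +↔⊎))
    where
    split : SetPartition (suc n) (suc j) → SetPartition n j ⊎ (Fin (suc j) × SetPartition n (suc j))
    split (new σ)   = inj₁ σ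
    split (old l σ) = inj₂ (l , σ)
    join : SetPartition n j ⊎ (Fin (suc j) × SetPartition n (suc j)) → SetPartition (suc n) (suc j)
    join (inj₁ σ)       = new σ
    join (inj₂ (l , σ)) = old l σ
    split-join : ∀ x → split (join x) ≡ x
    split-join (inj₁ σ)       = refl
    split-join (inj₂ (l , σ)) = refl
    join-split : ∀ σ → join (split σ) ≡ σ
    join-split (new σ)   = refl
    join-split (old l σ) = refl

  stirling₂-isRational : ∀ j → IsRationalSeries (λ n → + stirling₂ n j)
  stirling₂-isRational zero    = IsRationalSeries-resp (λ { zero → refl ; (suc n) → refl }) (coeff-isRational [ 1ℤ ])
  stirling₂-isRational (suc j) = recurrence-isRational (+ suc j) recurrence (stirling₂-isRational j)
    where
    recurrence : ∀ n → + stirling₂ (suc n) (suc j) ≡ + suc j ℤ.* + stirling₂ n (suc j) ℤ.+ + stirling₂ n j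
    recurrence n = begin
      + (stirling₂ n j + suc j * stirling₂ n (suc j))         ≡⟨ pos-+ (stirling₂ n j) _ ⟩
      + stirling₂ n j ℤ.+ + (suc j * stirling₂ n (suc j))     ≡⟨ cong (ℤ._+_ (+ stirling₂ n j)) (pos-* (suc j) _) ⟩
      + stirling₂ n j ℤ.+ + suc j ℤ.* + stirling₂ n (suc j)   ≡⟨ +-comm (+ stirling₂ n j) (+ suc j ℤ.* + stirling₂ n (suc j)) ⟩
      + suc j ℤ.* + stirling₂ n (suc j) ℤ.+ + stirling₂ n j   ∎
      where open ≡-Reasoning

module FiniteTypes where
  open import Level using (_⊔_)
  open import Data.Nat using (zero; suc)
  open import Data.Fin using (Fin; zero; suc)
  open import Data.Fin.Properties using (any?; +↔⊎)
  open import Data.Product using (∃)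
  open import Data.Empty using (⊥-elim)
  open import Data.Nat.Properties using (+-0-monoid)
  open import Algebra.Properties.Monoid.Sum +-0-monoid using (sum)
  open import Data.Sum using (_⊎_; inj₁; inj₂)
  open import Data.Sum.Function.Propositional using (_⊎-↔_)
  open import Function.Bundles using (_↔_; Inverse; mk↔ₛ′)
  open import Function.Properties.Inverse using (↔-sym; ↔-trans)
  open import Relation.Binary.Core using (Rel)
  open import Relation.Binary.Definitions using (Reflexive; Symmetric; Transitive) renaming (Decidable to Decidable₂)
  open import Relation.Binary.PropositionalEquality using (_≡_; refl; sym; trans; cong; subst)
  open import Relation.Nullary using (¬_; yes; no)
  open import Relation.Unary using (Pred; Decidable)

  record Transversal {i a p r} (I : Set i) {A : Set a} (P : Pred A p) (R : Rel A r) : Set (i ⊔ a ⊔ p ⊔ r) where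
    field
      rep           : I → A
      rep-∈         : ∀ x → P (rep x)
      rep-injective : ∀ x y → R (rep x) (rep y) → x ≡ y
      rep-covers    : ∀ a → P a → ∃ λ x → R a (rep x)
  open Transversal public

  FiniteTransversal : ∀ {a p r} {A : Set a} → Pred A p → Rel A r → Set (a ⊔ p ⊔ r)
  FiniteTransversal P R = Σ ℕ λ m → Transversal (Fin m) P R

  module _ {p r m M} {P : Pred (Fin (suc M)) p} {R : Rel (Fin (suc M)) r}
           (T : Transversal (Fin m) (λ i → P (suc i)) (λ i j → R (suc i) (suc j))) where

    Transversal-skip0 : (P zero → ∃ λ x → R zero (suc (rep T x))) → Transversal (Fin m) P R
    Transversal-skip0 cover₀ = record
      { rep           = λ x → suc (rep T x)
      ; rep-∈         = rep-∈ T
      ; rep-injective = rep-injective T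
      ; rep-covers    = λ { zero P₀ → cover₀ P₀ ; (suc i) Pi → rep-covers T i Pi }
      }

    Transversal-add0 : Reflexive R → Symmetric R → P zero →
                       ¬ (∃ λ x → R zero (suc (rep T x))) → Transversal (Fin (suc m)) P R
    Transversal-add0 R-refl R-sym P₀ fresh = record
      { rep = rep′ ; rep-∈ = rep′-∈ ; rep-injective = rep′-injective ; rep-covers = rep′-covers }
      where
      rep′ : Fin (suc m) → Fin (suc M)
      rep′ zero    = zero
      rep′ (suc x) = suc (rep T x)
      rep′-∈ : ∀ x → P (rep′ x)
      rep′-∈ zero    = P₀
      rep′-∈ (suc x) = rep-∈ T x
      rep′-injective : ∀ x y → R (rep′ x) (rep′ y) → x ≡ y
      rep′-injective zero    zero    _ = refl
      rep′-injective zero    (suc y) r = ⊥-elim (fresh (y , r))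
      rep′-injective (suc x) zero    r = ⊥-elim (fresh (x , R-sym r))
      rep′-injective (suc x) (suc y) r = cong suc (rep-injective T x y r)
      rep′-covers : ∀ i → P i → ∃ λ x → R i (rep′ x)
      rep′-covers zero    _  = zero , R-refl
      rep′-covers (suc i) Pi = let x , r = rep-covers T i Pi in suc x , r

  finiteTransversal : ∀ {p r} M {P : Pred (Fin M) p} {R : Rel (Fin M) r} →
    Decidable P → Decidable₂ R → Reflexive R → Symmetric R → FiniteTransversal P R
  finiteTransversal zero P? R? R-refl R-sym =
    0 , record { rep = λ () ; rep-∈ = λ () ; rep-injective = λ () ; rep-covers = λ () }
  finiteTransversal (suc M) P? R? R-refl R-sym
    with m , T ← finiteTransversal M (λ i → P? (suc i)) (λ i j → R? (suc i) (suc j)) R-refl R-sym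
    with P? zero | any? (λ x → R? zero (suc (rep T x)))
  ... | no ¬P₀ | _          = m , Transversal-skip0 T (λ P₀ → ⊥-elim (¬P₀ P₀))
  ... | yes _  | yes found  = m , Transversal-skip0 T (λ _ → found)
  ... | yes P₀ | no ¬found  = suc m , Transversal-add0 T R-refl R-sym P₀ ¬found

  Transversal-image : ∀ {i a b p r} {I : Set i} {A : Set a} {B : Set b} {P : Pred A p} {R : Rel A r}
    (f : B → A) → Transitive R → (∀ a → P a → ∃ λ b → P (f b) × R a (f b)) →
    Transversal I (λ b → P (f b)) (λ b b′ → R (f b) (f b′)) → Transversal I P R
  Transversal-image f R-trans reach T = record
    { rep           = λ x → f (rep T x)
    ; rep-∈         = rep-∈ T
    ; rep-injective = rep-injective T
    ; rep-covers    = λ a Pa → let b , Pfb , a~fb = reach a Pa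
                                   x , fb~rep = rep-covers T b Pfb
                               in x , R-trans a~fb fb~rep
    }

  Transversal-↔ : ∀ {i j a p r} {I : Set i} {J : Set j} {A : Set a} {P : Pred A p} {R : Rel A r} →
    I ↔ J → Transversal I P R → Transversal J P R
  Transversal-↔ {R = R} I↔J T = record
    { rep           = λ y → rep T (from y)
    ; rep-∈         = λ y → rep-∈ T (from y)
    ; rep-injective = λ y y′ r →
        trans (sym (strictlyInverseˡ y)) (trans (cong to (rep-injective T _ _ r)) (strictlyInverseˡ y′))
    ; rep-covers    = λ a Pa → let x , a~x = rep-covers T a Pa
                               in to x , subst (R a) (cong (rep T) (sym (strictlyInverseʳ x))) a~x
    }
    where open Inverse I↔J

  Σ↔∑ : ∀ K {P : Fin K → Set} (f : Fin K → ℕ) → (∀ j → P j ↔ Fin (f j)) → Σ (Fin K) P ↔ Fin (sum f)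
  Σ↔∑ zero    f e = mk↔ₛ′ (λ ()) (λ ()) (λ ()) (λ ())
  Σ↔∑ (suc K) {P} f e =
    ↔-trans (mk↔ₛ′ split join split-join join-split)
      (↔-trans (e zero ⊎-↔ Σ↔∑ K (λ j → f (suc j)) (λ j → e (suc j))) (↔-sym +↔⊎))
    where
    split : Σ (Fin (suc K)) P → P zero ⊎ Σ (Fin K) (λ j → P (suc j))
    split (zero  , x) = inj₁ x
    split (suc j , x) = inj₂ (j , x)
    join : P zero ⊎ Σ (Fin K) (λ j → P (suc j)) → Σ (Fin (suc K)) P
    join (inj₁ x)       = zero , x
    join (inj₂ (j , x)) = suc j , x
    split-join : ∀ x → split (join x) ≡ x
    split-join (inj₁ x)       = refl
    split-join (inj₂ (j , x)) = refl
    join-split : ∀ x → join (split x) ≡ x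
    join-split (zero  , x) = refl
    join-split (suc j , x) = refl

module FiniteRingOrbits {c ℓ} (A : Ring c ℓ) (finite : FiniteRing A) where
  open import Level using (_⊔_)
  open import Data.Nat as ℕ using (zero; suc; _^_; _≤_; s≤s)
  open import Data.Fin using (Fin; zero; suc; toℕ; fromℕ<; finToFun; funToFin)
  open import Data.Fin.Properties
    using (any?; all?; _≟_; injective⇒≤; toℕ-injective; toℕ-fromℕ<; finToFun-funToFin; *↔×)
  open import Data.Nat.Properties using (+-0-monoid)
  open import Algebra.Properties.Monoid.Sum +-0-monoid using (sum)
  open import Data.Product using (∃; proj₁; proj₂)
  open import Data.Product.Function.NonDependent.Propositional using (_×-↔_)
  open import Data.Vec.Functional using (_∷_)
  open import Data.Empty using (⊥-elim)
  open import Function.Bundles using (_↔_; Inverse)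
  open import Function.Properties.Inverse using (↔-refl; ↔-sym; ↔-trans)
  open import Relation.Binary.PropositionalEquality as ≡ using (_≡_; refl; cong)
  open import Relation.Nullary using (¬_; Dec; yes; no)
  open import Relation.Nullary.Decidable using (_×-dec_; _→-dec_; map′)
  open import Relation.Unary using (Pred)
  open Ring A using (Carrier; _≈_; _*_; 1#; *-cong; *-assoc; *-identityˡ; *-identityʳ; setoid)
    renaming (refl to ≈-refl; sym to ≈-sym; trans to ≈-trans; reflexive to ≈-reflexive)
  open import Relation.Binary.Reasoning.Setoid setoid
  open SetPartitions
  open FiniteTypes

  k : ℕ
  k = proj₁ finite

  open Inverse (proj₂ finite) renaming (to to index; from to element)

  element-index : ∀ x → element (index x) ≈ x
  element-index = strictlyInverseʳ

  index-injective : ∀ {x y} → index x ≡ index y → x ≈ y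
  index-injective {x} {y} eq = begin
    x                 ≈⟨ element-index x ⟨
    element (index x) ≡⟨ cong element eq ⟩
    element (index y) ≈⟨ element-index y ⟩
    y                 ∎

  _≈?_ : ∀ x y → Dec (x ≈ y)
  x ≈? y = map′ index-injective to-cong (index x ≟ index y)

  ∃? : ∀ {p} {P : Pred Carrier p} → (∀ {x y} → x ≈ y → P x → P y) → (∀ x → Dec (P x)) → Dec (∃ P)
  ∃? resp P? = map′ (λ (i , Pi) → element i , Pi)
                    (λ (x , Px) → index x , resp (≈-sym (element-index x)) Px)
                    (any? (λ i → P? (element i)))

  conj-cancel : ∀ {u v} x → v * u ≈ 1# → v * (u * x * v) * u ≈ x
  conj-cancel {u} {v} x vu≈1 = begin
    v * (u * x * v) * u     ≈⟨ *-cong (≈-sym (*-assoc v (u * x) v)) ≈-refl ⟩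
    v * (u * x) * v * u     ≈⟨ *-assoc (v * (u * x)) v u ⟩
    v * (u * x) * (v * u)   ≈⟨ *-cong (≈-sym (*-assoc v u x)) vu≈1 ⟩
    v * u * x * 1#          ≈⟨ *-identityʳ _ ⟩
    v * u * x               ≈⟨ *-cong vu≈1 ≈-refl ⟩
    1# * x                  ≈⟨ *-identityˡ x ⟩
    x                       ∎

  conj-injective : ∀ {u v x y} → v * u ≈ 1# → u * x * v ≈ u * y * v → x ≈ y
  conj-injective {u} {v} {x} {y} vu≈1 eq = begin
    x                    ≈⟨ conj-cancel x vu≈1 ⟨
    v * (u * x * v) * u  ≈⟨ *-cong (*-cong ≈-refl eq) ≈-refl ⟩
    v * (u * y * v) * u  ≈⟨ conj-cancel y vu≈1 ⟩
    y                    ∎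

  product-inverse : ∀ {p q r s} → q * r ≈ 1# → p * s ≈ 1# → (p * q) * (r * s) ≈ 1#
  product-inverse {p} {q} {r} {s} qr≈1 ps≈1 = begin
    (p * q) * (r * s)  ≈⟨ *-assoc p q (r * s) ⟩
    p * (q * (r * s))  ≈⟨ *-cong ≈-refl (*-assoc q r s) ⟨
    p * (q * r * s)    ≈⟨ *-cong ≈-refl (*-cong qr≈1 ≈-refl) ⟩
    p * (1# * s)       ≈⟨ *-cong ≈-refl (*-identityˡ s) ⟩
    p * s              ≈⟨ ps≈1 ⟩
    1#                 ∎

  conj-∘ : ∀ p q x r s → (p * q) * x * (r * s) ≈ p * (q * x * r) * s
  conj-∘ p q x r s = begin
    (p * q) * x * (r * s)  ≈⟨ *-assoc (p * q * x) r s ⟨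
    (p * q) * x * r * s    ≈⟨ *-cong (*-cong (*-assoc p q x) ≈-refl) ≈-refl ⟩
    p * (q * x) * r * s    ≈⟨ *-cong (*-assoc p (q * x) r) ≈-refl ⟩
    p * (q * x * r) * s    ∎

  Conj-refl : ∀ {n} {a : Tuple A n} → Conj A a a
  Conj-refl = 1# , 1# , *-identityˡ 1# , *-identityˡ 1# , λ i → ≈-trans (*-identityʳ _) (*-identityˡ _)

  Conj-sym : ∀ {n} {a b : Tuple A n} → Conj A a b → Conj A b a
  Conj-sym {a = a} {b} (u , v , uv≈1 , vu≈1 , uav≈b) = v , u , vu≈1 , uv≈1 , λ i → begin
    v * b i * u            ≈⟨ *-cong (*-cong ≈-refl (uav≈b i)) ≈-refl ⟨
    v * (u * a i * v) * u  ≈⟨ conj-cancel (a i) vu≈1 ⟩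
    a i                    ∎

  Conj-trans : ∀ {n} {a b d : Tuple A n} → Conj A a b → Conj A b d → Conj A a d
  Conj-trans {a = a} {b} {d} (u , v , uv≈1 , vu≈1 , uav≈b) (u′ , v′ , u′v′≈1 , v′u′≈1 , u′bv′≈d) =
    u′ * u , v * v′ , product-inverse uv≈1 u′v′≈1 , product-inverse v′u′≈1 vu≈1 , λ i → begin
      (u′ * u) * a i * (v * v′)  ≈⟨ conj-∘ u′ u (a i) v v′ ⟩
      u′ * (u * a i * v) * v′    ≈⟨ *-cong (*-cong ≈-refl (uav≈b i)) ≈-refl ⟩
      u′ * b i * v′              ≈⟨ u′bv′≈d i ⟩
      d i                        ∎

  Conj-reindex : ∀ {m n} {a b : Tuple A n} {a′ b′ : Tuple A m} (f : Fin m → Fin n) →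
                 (∀ i → a′ i ≈ a (f i)) → (∀ i → b (f i) ≈ b′ i) → Conj A a b → Conj A a′ b′
  Conj-reindex {a = a} {b} {a′} {b′} f a′≈af bf≈b′ (u , v , uv≈1 , vu≈1 , uav≈b) =
    u , v , uv≈1 , vu≈1 , λ i → begin
      u * a′ i * v     ≈⟨ *-cong (*-cong ≈-refl (a′≈af i)) ≈-refl ⟩
      u * a (f i) * v  ≈⟨ uav≈b (f i) ⟩
      b (f i)          ≈⟨ bf≈b′ i ⟩
      b′ i             ∎

  Conj-≈ : ∀ {n} {a b : Tuple A n} → (∀ i → a i ≈ b i) → Conj A a b
  Conj-≈ a≈b = Conj-reindex (λ i → i) a≈b (λ _ → ≈-refl) Conj-refl

  ConjugatesBy : ∀ {n} → Tuple A n → Tuple A n → Carrier → Carrier → Set ℓ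
  ConjugatesBy a b u v = (u * v ≈ 1#) × (v * u ≈ 1#) × (∀ i → u * a i * v ≈ b i)

  ConjugatesBy-resp : ∀ {n} {a b : Tuple A n} {u u′ v v′} → u ≈ u′ → v ≈ v′ →
                      ConjugatesBy a b u v → ConjugatesBy a b u′ v′
  ConjugatesBy-resp u≈u′ v≈v′ (uv≈1 , vu≈1 , uav≈b) =
    ≈-trans (*-cong (≈-sym u≈u′) (≈-sym v≈v′)) uv≈1 ,
    ≈-trans (*-cong (≈-sym v≈v′) (≈-sym u≈u′)) vu≈1 ,
    λ i → ≈-trans (*-cong (*-cong (≈-sym u≈u′) ≈-refl) (≈-sym v≈v′)) (uav≈b i)

  conj? : ∀ {n} (a b : Tuple A n) → Dec (Conj A a b)
  conj? a b =
    ∃? (λ u≈u′ (v , h) → v , ConjugatesBy-resp u≈u′ ≈-refl h) λ u →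
    ∃? (λ v≈v′ → ConjugatesBy-resp ≈-refl v≈v′) λ v →
    ((u * v) ≈? 1#) ×-dec ((v * u) ≈? 1#) ×-dec all? (λ i → (u * a i * v) ≈? b i)

  commuting? : ∀ {n} (a : Tuple A n) → Dec (Commuting A a)
  commuting? a = all? λ i → all? λ j → (a i * a j) ≈? (a j * a i)

  Distinct : ∀ {n} → Tuple A n → Set ℓ
  Distinct a = ∀ i j → a i ≈ a j → i ≡ j

  distinct? : ∀ {n} (a : Tuple A n) → Dec (Distinct a)
  distinct? a = all? λ i → all? λ j → (a i ≈? a j) →-dec (i ≟ j)

  Commuting-resp : ∀ {n} {a b : Tuple A n} → (∀ i → a i ≈ b i) → Commuting A a → Commuting A b
  Commuting-resp {a = a} {b} a≈b comm i j = begin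
    b i * b j  ≈⟨ *-cong (a≈b i) (a≈b j) ⟨
    a i * a j  ≈⟨ comm i j ⟩
    a j * a i  ≈⟨ *-cong (a≈b j) (a≈b i) ⟩
    b j * b i  ∎

  Distinct-resp : ∀ {n} {a b : Tuple A n} → (∀ i → a i ≈ b i) → Distinct a → Distinct b
  Distinct-resp a≈b distinct i j bi≈bj = distinct i j (≈-trans (a≈b i) (≈-trans bi≈bj (≈-sym (a≈b j))))

  Distinct⇒≤ : ∀ {j} {v : Tuple A j} → Distinct v → j ≤ k
  Distinct⇒≤ {v = v} distinct = injective⇒≤ {f = λ l → index (v l)} (λ eq → distinct _ _ (index-injective eq))

  Distinct-∷ : ∀ {j x} {v : Tuple A j} → ¬ (∃ λ l → x ≈ v l) → Distinct v → Distinct (x ∷ v)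
  Distinct-∷ fresh distinct zero    zero    _  = refl
  Distinct-∷ fresh distinct zero    (suc l) eq = ⊥-elim (fresh (l , eq))
  Distinct-∷ fresh distinct (suc l) zero    eq = ⊥-elim (fresh (l , ≈-sym eq))
  Distinct-∷ fresh distinct (suc l) (suc m) eq = cong suc (distinct l m eq)

  decode : ∀ {j} → Fin (k ^ j) → Tuple A j
  decode i l = element (finToFun i l)

  encode : ∀ {j} → Tuple A j → Fin (k ^ j)
  encode a = funToFin (λ l → index (a l))

  decode-encode : ∀ {j} (a : Tuple A j) l → decode (encode a) l ≈ a l
  decode-encode a l = ≈-trans (≈-reflexive (cong element (finToFun-funToFin _ l))) (element-index (a l))

  distinctOrbits : ∀ j → FiniteTransversal {A = Tuple A j} (λ a → Commuting A a × Distinct a) (Conj A)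
  distinctOrbits j =
    let m , T = finiteTransversal (k ^ j)
                  (λ i → commuting? (decode i) ×-dec distinct? (decode i))
                  (λ i i′ → conj? (decode i) (decode i′)) Conj-refl Conj-sym
    in m , Transversal-image decode Conj-trans reach T
    where
    reach : ∀ a → Commuting A a × Distinct a →
            ∃ λ i → (Commuting A (decode i) × Distinct (decode i)) × Conj A a (decode i)
    reach a (comm , distinct) =
      let a≈ = λ l → ≈-sym (decode-encode a l)
      in encode a , (Commuting-resp a≈ comm , Distinct-resp a≈ distinct) , Conj-≈ a≈

  Factorisation : ∀ {n} → Tuple A n → Set (c ⊔ ℓ)
  Factorisation {n} a = Σ ℕ λ j → Σ (SetPartition n j) λ σ → Σ (Tuple A j) λ v →
                          Distinct v × (∀ i → a i ≈ v (block σ i))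

  factorise : ∀ n (a : Tuple A n) → Factorisation a
  factorise zero    a = 0 , [] , (λ ()) , (λ ()) , (λ ())
  factorise (suc n) a
    with j , σ , v , distinct , a≈vσ ← factorise n (λ i → a (suc i))
    with any? (λ l → a zero ≈? v l)
  ... | yes (l , a₀≈vl) = j , old l σ , v , distinct , λ { zero → a₀≈vl ; (suc i) → a≈vσ i }
  ... | no fresh        = suc j , new σ , a zero ∷ v , Distinct-∷ fresh distinct ,
                          λ { zero → ≈-refl ; (suc i) → a≈vσ i }

  Commuting-∘-surjective : ∀ {n j} {v : Tuple A j} (σ : SetPartition n j) →
                           Commuting A (λ i → v (block σ i)) → Commuting A v
  Commuting-∘-surjective σ comm l l′
    with i , refl ← block-surjective σ l
    with i′ , refl ← block-surjective σ l′
    = comm i i′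

  Conj-∘-surjective : ∀ {n j} {v w : Tuple A j} (σ : SetPartition n j) →
                      Conj A (λ i → v (block σ i)) (λ i → w (block σ i)) → Conj A v w
  Conj-∘-surjective {v = v} {w} σ = Conj-reindex (λ l → proj₁ (block-surjective σ l))
    (λ l → ≈-reflexive (cong v (≡.sym (proj₂ (block-surjective σ l)))))
    (λ l → ≈-reflexive (cong w (proj₂ (block-surjective σ l))))

  orbitSize : ℕ → ℕ
  orbitSize j = proj₁ (distinctOrbits j)

  module DistinctReps (j : ℕ) = Transversal (proj₂ (distinctOrbits j))

  -- j ranges over Fin (suc k) because a tuple has at most k distinct entries
  OrbitCode : ℕ → Set
  OrbitCode n = Σ (Fin (suc k)) λ J → SetPartition n (toℕ J) × Fin (orbitSize (toℕ J))

  orbitRep : ∀ {n} → OrbitCode n → Tuple A n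
  orbitRep (J , σ , x) i = DistinctReps.rep (toℕ J) x (block σ i)

  orbitRep-commuting : ∀ {n} (X : OrbitCode n) → Commuting A (orbitRep X)
  orbitRep-commuting (J , σ , x) i i′ = proj₁ (DistinctReps.rep-∈ (toℕ J) x) (block σ i) (block σ i′)

  orbitRep-injective : ∀ {n} (X Y : OrbitCode n) → Conj A (orbitRep X) (orbitRep Y) → X ≡ Y
  orbitRep-injective (J , σ , x) (J′ , σ′ , x′) conj@(u , v , _ , vu≈1 , h) =
    sameCode (sameBlocks⇒≡ σ σ′ same) (toℕ-injective (cong proj₁ (sameBlocks⇒≡ σ σ′ same))) conj
    where
    r  = DistinctReps.rep (toℕ J) x
    r′ = DistinctReps.rep (toℕ J′) x′
    same : SameBlocks σ σ′
    same i i′ =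
      (λ eq → proj₂ (DistinctReps.rep-∈ (toℕ J′) x′) _ _ (begin
        r′ (block σ′ i)          ≈⟨ h i ⟨
        u * r (block σ i) * v    ≡⟨ cong (λ l → u * r l * v) eq ⟩
        u * r (block σ i′) * v   ≈⟨ h i′ ⟩
        r′ (block σ′ i′)         ∎)) ,
      (λ eq → proj₂ (DistinctReps.rep-∈ (toℕ J) x) _ _ (conj-injective vu≈1 (begin
        u * r (block σ i) * v    ≈⟨ h i ⟩
        r′ (block σ′ i)          ≡⟨ cong r′ eq ⟩
        r′ (block σ′ i′)         ≈⟨ h i′ ⟨
        u * r (block σ i′) * v   ∎)))
    sameCode : ∀ {σ′ : SetPartition _ (toℕ J′)} {x′} →
               _≡_ {A = Σ ℕ (SetPartition _)} (toℕ J , σ) (toℕ J′ , σ′) → J ≡ J′ →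
               Conj A (orbitRep (J , σ , x)) (orbitRep (J′ , σ′ , x′)) → (J , σ , x) ≡ (J′ , σ′ , x′)
    sameCode {x′ = x′} refl refl conj =
      cong (λ y → J , σ , y) (DistinctReps.rep-injective (toℕ J) x x′ (Conj-∘-surjective σ conj))

  orbitRep-covers : ∀ {n} (a : Tuple A n) → Commuting A a → ∃ λ X → Conj A a (orbitRep X)
  orbitRep-covers {n} a comm with j , σ , v , distinct , a≈vσ ← factorise n a =
    cover (fromℕ< (s≤s (Distinct⇒≤ distinct))) (toℕ-fromℕ< _) σ v distinct
          (Commuting-∘-surjective σ (Commuting-resp a≈vσ comm)) a≈vσ
    where
    cover : ∀ {j} (J : Fin (suc k)) → toℕ J ≡ j → (σ : SetPartition n j) (v : Tuple A j) →
            Distinct v → Commuting A v → (∀ i → a i ≈ v (block σ i)) → ∃ λ X → Conj A a (orbitRep X)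
    cover J refl σ v distinct comm a≈vσ =
      let x , v~rep = DistinctReps.rep-covers (toℕ J) v (comm , distinct)
      in (J , σ , x) , Conj-reindex (block σ) a≈vσ (λ _ → ≈-refl) v~rep

  orbitReps : ∀ n → Transversal (OrbitCode n) (Commuting A {n}) (Conj A)
  orbitReps n = record
    { rep = orbitRep ; rep-∈ = orbitRep-commuting ; rep-injective = orbitRep-injective ; rep-covers = orbitRep-covers }

  orbitCount : ℕ → ℕ
  orbitCount n = sum λ (J : Fin (suc k)) → stirling₂ n (toℕ J) ℕ.* orbitSize (toℕ J)

  OrbitCode↔orbitCount : ∀ n → OrbitCode n ↔ Fin (orbitCount n)
  OrbitCode↔orbitCount n =
    Σ↔∑ (suc k) (λ J → stirling₂ n (toℕ J) ℕ.* orbitSize (toℕ J)) λ J → ↔-trans (SetPartition↔stirling₂ n (toℕ J) ×-↔ ↔-refl) (↔-sym (*↔× {stirling₂ n (toℕ J)}))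

  orbitCount-correct : ∀ n → OrbitCount A n (orbitCount n)
  orbitCount-correct n = rep T , rep-∈ T , rep-injective T , rep-covers T
    where T = Transversal-↔ (OrbitCode↔orbitCount n) (orbitReps n)

open import Data.Nat using (suc; _*_)
open import Data.Fin using (toℕ)
open RationalSeries using (∑-isRational; *-isRational)
open SetPartitions using (stirling₂; stirling₂-isRational)

theorem5 : ∀ {c ℓ} (A : Ring c ℓ) → FiniteRing A →
    Σ (ℕ → ℕ) λ cA → (∀ n → OrbitCount A n (cA n)) × IsRationalSeries (λ n → + cA n)
theorem5 A finite = orbitCount , orbitCount-correct ,
  ∑-isRational (suc k) (λ J n → stirling₂ n (toℕ J) * orbitSize (toℕ J))
    (λ J → *-isRational (orbitSize (toℕ J)) (stirling₂-isRational (toℕ J)))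
  where open FiniteRingOrbits A finite
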